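{- Let $T=(T[1],\dots,T[n])$ be a single-row intensity matrix with row-difference $D$, and let $\mathcal S$ be any segmentation of $T$. Then there exists a segmentation $\mathcal S'$ of $T$ with $|\mathcal S'|\le|\mathcal S|$ in which every segment has value at most $D$.
   Context: A single-row intensity matrix is a row of non-negative integers. A segment is a $1\times n$ row with non-negative integer entries whose non-zero entries all equal the same positive integer (its value) and occupy consecutive positions; a segmentation of $T$ is a finite multiset of segments summing to $T$, and $|\mathcal S|$ is its number of segments. The row-difference of $T$ is $D=\max\bigl(T[1],\,T[n],\,\max_{1\le j<n}|T[j+1]-T[j]|\bigr)$. -}

module Defs where

open import Data.Nat using (ℕ; zero; suc; _+_; _≤_; _<_; _⊔_; ∣_-_∣)
open import Data.Nat.Properties using (_≤?_)
open import Data.Fin using (Fin; toℕ; inject₁; fromℕ) renaming (zero to fzero; suc to fsuc)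
open import Data.List using (List; []; _∷_; foldr; length)
open import Data.Bool using (if_then_else_)
open import Relation.Nullary.Decidable using (⌊_⌋; _×-dec_)
open import Relation.Binary.PropositionalEquality using (_≡_)

Row : ℕ → Set
Row n = Fin n → ℕ

-- A segment of length n: value v ≥ 1 on the consecutive positions l..r (l ≤ r), 0 elsewhere.
record Segment (n : ℕ) : Set where
  constructor segment
  field
    value : ℕ
    value-pos : 1 ≤ value
    left  : Fin n
    right : Fin n
    left≤right : toℕ left ≤ toℕ right
open Segment public

segRow : ∀ {n} → Segment n → Row n
segRow s j =
  if ⌊ (toℕ (left s) ≤? toℕ j) ×-dec (toℕ j ≤? toℕ (right s)) ⌋
  then value s else 0

-- A (finite multiset of) segments, represented as a list.
Segmentation : ℕ → Set
Segmentation n = List (Segment n)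

sumSegs : ∀ {n} → Segmentation n → Row n
sumSegs ss j = foldr (λ s acc → segRow s j + acc) 0 ss

IsSegmentationOf : ∀ {n} → Segmentation n → Row n → Set
IsSegmentationOf ss T = ∀ j → sumSegs ss j ≡ T j

maxDiff : ∀ m → Row (suc m) → ℕ
maxDiff zero T = 0
maxDiff (suc m) T = ∣ T (fsuc fzero) - T fzero ∣ ⊔ maxDiff m (λ j → T (fsuc j))

rowDiff : ∀ {m} → Row (suc m) → ℕ
rowDiff {m} T = T fzero ⊔ T (fromℕ m) ⊔ maxDiff m T

module Submission where

-- Measure a segmentation by its weight, the sum of its values.  If some
-- segment s has value v > D, then s does not start at position 0 (there
-- v ≤ T[0] ≤ D), and some other segment t must end just before s starts:
-- otherwise every other segment contributes at least as much at position
-- left s as one step earlier, so the row rises by at least v there, giving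
-- v ≤ D.  Two adjacent segments t = [a,p] (value w) and s = [p+1,r] (value v)
-- can be replaced by [a,r] with value w ⊓ v together with at most one
-- remainder segment ([a,p] with value w ∸ v, or [p+1,r] with value v ∸ w);
-- this keeps the row, does not increase the count and lowers the weight.
-- Iterating terminates by well-founded recursion on the weight.

open import Defs
open import Data.Bool using (true; false; if_then_else_)
open import Data.Empty using (⊥-elim)
open import Data.Fin using (Fin; toℕ; inject₁) renaming (zero to fzero; suc to fsuc)
open import Data.Fin.Properties using (toℕ-inject₁)
open import Data.List using (List; []; _∷_; _++_; length; foldr; map)
open import Data.List.Properties using (length-++; foldr-map)
open import Data.List.Relation.Binary.Permutation.Propositional as ↭ using (_↭_)
open import Data.List.Relation.Binary.Permutation.Propositional.Properties using (↭-length; map⁺)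
open import Data.List.Relation.Unary.All using (All; []; _∷_; all?)
open import Data.List.Relation.Unary.All.Properties using (¬Any⇒All¬; ¬All⇒Any¬)
open import Data.List.Relation.Unary.Any as Any using (Any; here; there; any?; _─_)
open import Data.List.Relation.Unary.Any.Properties using (lookup-result)
open import Data.Nat using (ℕ; zero; suc; _+_; _∸_; _≤_; _<_; _⊓_; ∣_-_∣; z≤n; s≤s; _≟_)
open import Data.Nat.Induction using (<-wellFounded)
open import Data.Nat.ListAction using (sum)
open import Data.Nat.ListAction.Properties using (sum-↭)
open import Data.Nat.Properties
open import Algebra.Properties.CommutativeSemigroup +-commutativeSemigroup using (interchange)
open import Data.Product using (Σ; _×_; _,_; proj₁; proj₂)
open import Data.Sum using (_⊎_; inj₁; inj₂)
open import Induction.WellFounded using (Acc; acc)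
open import Relation.Nullary using (yes; no)
open import Relation.Nullary.Decidable using (⌊_⌋; _×-dec_)
open import Relation.Binary.PropositionalEquality
  using (_≡_; _≢_; _≗_; refl; sym; trans; cong; cong₂; subst; module ≡-Reasoning)

-- box a b v k is v when a ≤ k ≤ b and 0 otherwise; a segment's row is
-- definitionally a box read at toℕ of the position.
box : ℕ → ℕ → ℕ → ℕ → ℕ
box a b v k = if ⌊ (a ≤? k) ×-dec (k ≤? b) ⌋ then v else 0

box-inside : ∀ a b v {k} → a ≤ k → k ≤ b → box a b v k ≡ v
box-inside a b v {k} a≤k k≤b with a ≤? k | k ≤? b
... | yes _   | yes _   = refl
... | no a≰k  | _       = ⊥-elim (a≰k a≤k)
... | yes _   | no k≰b  = ⊥-elim (k≰b k≤b)

box-before : ∀ a b v {k} → k < a → box a b v k ≡ 0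
box-before a b v {k} k<a with a ≤? k
... | yes a≤k = ⊥-elim (<⇒≱ k<a a≤k)
... | no _    = refl

box-after : ∀ a b v {k} → b < k → box a b v k ≡ 0
box-after a b v {k} b<k with a ≤? k | k ≤? b
... | _     | yes k≤b = ⊥-elim (<⇒≱ b<k k≤b)
... | yes _ | no _    = refl
... | no _  | no _    = refl

box-+ : ∀ a b x y k → box a b (x + y) k ≡ box a b x k + box a b y k
box-+ a b x y k with ⌊ (a ≤? k) ×-dec (k ≤? b) ⌋
... | true  = refl
... | false = refl

box-zero : ∀ a b k → box a b 0 k ≡ 0
box-zero a b k with ⌊ (a ≤? k) ×-dec (k ≤? b) ⌋
... | true  = refl
... | false = refl

box-right-irrelevant : ∀ a {b b′} v {k} → k ≤ b → k ≤ b′ → box a b v k ≡ box a b′ v k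
box-right-irrelevant a {b} {b′} v {k} k≤b k≤b′ with ≤-<-connex a k
... | inj₁ a≤k = trans (box-inside a b v a≤k k≤b) (sym (box-inside a b′ v a≤k k≤b′))
... | inj₂ k<a = trans (box-before a b v k<a) (sym (box-before a b′ v k<a))

box-left-irrelevant : ∀ {a a′} b v {k} → a ≤ k → a′ ≤ k → box a b v k ≡ box a′ b v k
box-left-irrelevant {a} {a′} b v {k} a≤k a′≤k with ≤-<-connex k b
... | inj₁ k≤b = trans (box-inside a b v a≤k k≤b) (sym (box-inside a′ b v a′≤k k≤b))
... | inj₂ b<k = trans (box-after a b v b<k) (sym (box-after a′ b v b<k))

box-split : ∀ a p r v k → a ≤ suc p → p ≤ r → box a p v k + box (suc p) r v k ≡ box a r v k
box-split a p r v k a≤p+1 p≤r with ≤-<-connex k p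
... | inj₁ k≤p = begin
  box a p v k + box (suc p) r v k ≡⟨ cong (box a p v k +_) (box-before (suc p) r v (s≤s k≤p)) ⟩
  box a p v k + 0                 ≡⟨ +-identityʳ _ ⟩
  box a p v k                     ≡⟨ box-right-irrelevant a v k≤p (≤-trans k≤p p≤r) ⟩
  box a r v k                     ∎
  where open ≡-Reasoning
... | inj₂ p<k = begin
  box a p v k + box (suc p) r v k ≡⟨ cong (_+ box (suc p) r v k) (box-after a p v p<k) ⟩
  box (suc p) r v k               ≡⟨ box-left-irrelevant r v p<k (≤-trans a≤p+1 p<k) ⟩
  box a r v k                     ∎
  where open ≡-Reasoning

box-exchange : ∀ a p q r w v k → suc p ≡ q → a ≤ q → p ≤ r →
  box a p w k + box q r v k ≡ box a r (w ⊓ v) k + (box a p (w ∸ v) k + box q r (v ∸ w) k)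
box-exchange a p .(suc p) r w v k refl a≤q p≤r = begin
  box a p w k + box (suc p) r v k
    ≡⟨ cong₂ _+_ (cong (λ x → box a p x k) (sym w-parts)) (cong (λ x → box (suc p) r x k) (sym v-parts)) ⟩
  box a p (u + (w ∸ v)) k + box (suc p) r (u + (v ∸ w)) k
    ≡⟨ cong₂ _+_ (box-+ a p u (w ∸ v) k) (box-+ (suc p) r u (v ∸ w) k) ⟩
  (box a p u k + box a p (w ∸ v) k) + (box (suc p) r u k + box (suc p) r (v ∸ w) k)
    ≡⟨ interchange (box a p u k) (box a p (w ∸ v) k) (box (suc p) r u k) (box (suc p) r (v ∸ w) k) ⟩
  (box a p u k + box (suc p) r u k) + (box a p (w ∸ v) k + box (suc p) r (v ∸ w) k)
    ≡⟨ cong (_+ (box a p (w ∸ v) k + box (suc p) r (v ∸ w) k)) (box-split a p r u k a≤q p≤r) ⟩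
  box a r u k + (box a p (w ∸ v) k + box (suc p) r (v ∸ w) k) ∎
  where
  open ≡-Reasoning
  u = w ⊓ v
  w-parts : u + (w ∸ v) ≡ w
  w-parts = trans (cong (_+ (w ∸ v)) (⊓-comm w v)) (m⊓n+n∸m≡n v w)
  v-parts : u + (v ∸ w) ≡ v
  v-parts = m⊓n+n∸m≡n w v

box-step : ∀ a b v {p} → b ≢ p → box a b v p ≤ box a b v (suc p)
box-step a b v {p} b≢p with ≤-<-connex a p | <-≤-connex p b
... | inj₁ a≤p | inj₁ p<b =
  ≤-reflexive (trans (box-inside a b v a≤p (<⇒≤ p<b)) (sym (box-inside a b v (m≤n⇒m≤1+n a≤p) p<b)))
... | inj₂ p<a | _        = ≤-trans (≤-reflexive (box-before a b v p<a)) z≤n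
... | inj₁ _   | inj₂ b≤p = ≤-trans (≤-reflexive (box-after a b v (≤∧≢⇒< b≤p b≢p))) z≤n

-- The total of a quantity over a list; sumSegs S j is definitionally the total
-- of (λ s → segRow s j), and the weight of a segmentation is its total value.
total : ∀ {A : Set} → (A → ℕ) → List A → ℕ
total f = foldr (λ x acc → f x + acc) 0

weight : ∀ {n} → Segmentation n → ℕ
weight = total value

total-++ : ∀ {A : Set} (f : A → ℕ) xs {ys} → total f (xs ++ ys) ≡ total f xs + total f ys
total-++ f []       = refl
total-++ f (x ∷ xs) {ys} = trans (cong (f x +_) (total-++ f xs)) (sym (+-assoc (f x) (total f xs) (total f ys)))

total-↭ : ∀ {A : Set} (f : A → ℕ) {xs ys} → xs ↭ ys → total f xs ≡ total f ys
total-↭ f {xs} {ys} xs↭ys = begin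
  total f xs       ≡⟨ sym (foldr-map _+_ f 0 xs) ⟩
  sum (map f xs)   ≡⟨ sum-↭ (map⁺ f xs↭ys) ⟩
  sum (map f ys)   ≡⟨ foldr-map _+_ f 0 ys ⟩
  total f ys       ∎
  where open ≡-Reasoning

lookup-─ : ∀ {A : Set} {P : A → Set} {xs} (p : Any P xs) → Any.lookup p ∷ (xs ─ p) ↭ xs
lookup-─ (here _)  = ↭.refl
lookup-─ (there p) = ↭.trans (↭.swap _ _ ↭.refl) (↭.prep _ (lookup-─ p))

segmentation-↭ : ∀ {n} {T : Row n} {L S : Segmentation n} → L ↭ S → IsSegmentationOf S T → IsSegmentationOf L T
segmentation-↭ L↭S seg j = trans (total-↭ (λ s → segRow s j) L↭S) (seg j)

record Improves {n} (S′ S : Segmentation n) : Set where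
  constructor improves
  field
    same-row  : sumSegs S′ ≗ sumSegs S
    no-longer : length S′ ≤ length S
    lighter   : weight S′ < weight S

improves-++ʳ : ∀ {n} {M L : Segmentation n} R → Improves M L → Improves (M ++ R) (L ++ R)
improves-++ʳ {M = M} {L} R (improves same shorter lighter) = improves sums lengths weights
  where
  sums : sumSegs (M ++ R) ≗ sumSegs (L ++ R)
  sums j = begin
    sumSegs (M ++ R) j            ≡⟨ total-++ (λ s → segRow s j) M ⟩
    sumSegs M j + sumSegs R j     ≡⟨ cong (_+ sumSegs R j) (same j) ⟩
    sumSegs L j + sumSegs R j     ≡⟨ sym (total-++ (λ s → segRow s j) L) ⟩
    sumSegs (L ++ R) j            ∎
    where open ≡-Reasoning
  lengths : length (M ++ R) ≤ length (L ++ R)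
  lengths = begin
    length (M ++ R)         ≡⟨ length-++ M ⟩
    length M + length R     ≤⟨ +-monoˡ-≤ (length R) shorter ⟩
    length L + length R     ≡⟨ length-++ L ⟨
    length (L ++ R)         ∎
    where open ≤-Reasoning
  weights : weight (M ++ R) < weight (L ++ R)
  weights = begin-strict
    weight (M ++ R)         ≡⟨ total-++ value M ⟩
    weight M + weight R     <⟨ +-monoˡ-< (weight R) lighter ⟩
    weight L + weight R     ≡⟨ total-++ value L ⟨
    weight (L ++ R)         ∎
    where open ≤-Reasoning

improves-↭ : ∀ {n} {S′ L S : Segmentation n} → Improves S′ L → L ↭ S → Improves S′ S
improves-↭ (improves same shorter lighter) L↭S = improves
  (λ j → trans (same j) (total-↭ (λ s → segRow s j) L↭S))
  (≤-trans shorter (≤-reflexive (↭-length L↭S)))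
  (<-≤-trans lighter (≤-reflexive (total-↭ value L↭S)))

resized : ∀ {n} → ℕ → Segment n → Segmentation n
resized zero    s = []
resized (suc k) s = segment (suc k) (s≤s z≤n) (left s) (right s) (left≤right s) ∷ []

sumSegs-resized : ∀ {n} k (s : Segment n) j →
  sumSegs (resized k s) j ≡ box (toℕ (left s)) (toℕ (right s)) k (toℕ j)
sumSegs-resized zero    s j = sym (box-zero (toℕ (left s)) (toℕ (right s)) (toℕ j))
sumSegs-resized (suc k) s j = +-identityʳ _

weight-resized : ∀ {n} k (s : Segment n) → weight (resized k s) ≡ k
weight-resized zero    s = refl
weight-resized (suc k) s = +-identityʳ (suc k)

length-resized : ∀ {n} k (s : Segment n) → length (resized k s) ≤ 1
length-resized zero    s = z≤n
length-resized (suc k) s = ≤-refl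

length-resized-pair : ∀ {n} x y (t s : Segment n) → x ≡ 0 ⊎ y ≡ 0 → length (resized x t ++ resized y s) ≤ 1
length-resized-pair zero    y       t s _         = length-resized y s
length-resized-pair (suc x) zero    t s _         = ≤-refl
length-resized-pair (suc x) (suc y) t s (inj₁ ())
length-resized-pair (suc x) (suc y) t s (inj₂ ())

∸-zero-either : ∀ w v → w ∸ v ≡ 0 ⊎ v ∸ w ≡ 0
∸-zero-either w v with ≤-total w v
... | inj₁ w≤v = inj₁ (m≤n⇒m∸n≡0 w≤v)
... | inj₂ v≤w = inj₂ (m≤n⇒m∸n≡0 v≤w)

positive-∸-< : ∀ {m n} → 1 ≤ m → 1 ≤ n → m ∸ n < m
positive-∸-< {suc m} {suc n} (s≤s z≤n) (s≤s z≤n) = s≤s (m∸n≤m m n)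

-- The weight drops from w + v to w ⊔ v.
merge-adjacent : ∀ {n} (t s : Segment n) → suc (toℕ (right t)) ≡ toℕ (left s) →
  Σ (Segmentation n) λ M → Improves M (t ∷ s ∷ [])
merge-adjacent {n} t s adjacent = spanning ∷ remainders , improves sums (s≤s lengths) weights
  where
  a = toℕ (left t)
  p = toℕ (right t)
  q = toℕ (left s)
  r = toℕ (right s)
  w = value t
  v = value s

  spanning : Segment n
  spanning = segment (w ⊓ v) (⊓-glb (value-pos t) (value-pos s)) (left t) (right s)
    (≤-trans (left≤right t) (≤-trans (n≤1+n p) (≤-trans (≤-reflexive adjacent) (left≤right s))))

  remainders : Segmentation n
  remainders = resized (w ∸ v) t ++ resized (v ∸ w) s

  sums : sumSegs (spanning ∷ remainders) ≗ sumSegs (t ∷ s ∷ [])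
  sums j = begin
    box a r (w ⊓ v) k + sumSegs remainders j
      ≡⟨ cong (box a r (w ⊓ v) k +_) (total-++ (λ x → segRow x j) (resized (w ∸ v) t)) ⟩
    box a r (w ⊓ v) k + (sumSegs (resized (w ∸ v) t) j + sumSegs (resized (v ∸ w) s) j)
      ≡⟨ cong (box a r (w ⊓ v) k +_) (cong₂ _+_ (sumSegs-resized (w ∸ v) t j) (sumSegs-resized (v ∸ w) s j)) ⟩
    box a r (w ⊓ v) k + (box a p (w ∸ v) k + box q r (v ∸ w) k)
      ≡⟨ box-exchange a p q r w v k adjacent (≤-trans (left≤right t) (≤-trans (n≤1+n p) (≤-reflexive adjacent)))
           (≤-trans (n≤1+n p) (≤-trans (≤-reflexive adjacent) (left≤right s))) ⟨
    box a p w k + box q r v k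
      ≡⟨ cong (box a p w k +_) (+-identityʳ (box q r v k)) ⟨
    box a p w k + (box q r v k + 0) ∎
    where
    open ≡-Reasoning
    k = toℕ j

  lengths : length remainders ≤ 1
  lengths = length-resized-pair (w ∸ v) (v ∸ w) t s (∸-zero-either w v)

  weights : weight (spanning ∷ remainders) < w + (v + 0)
  weights = begin-strict
    w ⊓ v + weight remainders            ≡⟨ cong (w ⊓ v +_) (total-++ value (resized (w ∸ v) t)) ⟩
    w ⊓ v + (weight (resized (w ∸ v) t) + weight (resized (v ∸ w) s))
                                         ≡⟨ cong (w ⊓ v +_) (cong₂ _+_ (weight-resized (w ∸ v) t) (weight-resized (v ∸ w) s)) ⟩
    w ⊓ v + ((w ∸ v) + (v ∸ w))          ≡⟨ +-assoc (w ⊓ v) (w ∸ v) (v ∸ w) ⟨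
    (w ⊓ v + (w ∸ v)) + (v ∸ w)          ≡⟨ cong (_+ (v ∸ w)) (trans (cong (_+ (w ∸ v)) (⊓-comm w v)) (m⊓n+n∸m≡n v w)) ⟩
    w + (v ∸ w)                          <⟨ +-monoʳ-< w (positive-∸-< (value-pos s) (value-pos t)) ⟩
    w + v                                ≡⟨ cong (w +_) (+-identityʳ v) ⟨
    w + (v + 0)                          ∎
    where open ≤-Reasoning

value≤row-at-left : ∀ {n} {T : Row n} (s : Segment n) (rest : Segmentation n) →
  IsSegmentationOf (s ∷ rest) T → value s ≤ T (left s)
value≤row-at-left {T = T} s rest seg = begin
  value s                                       ≡⟨ box-inside (toℕ (left s)) (toℕ (right s)) (value s) ≤-refl (left≤right s) ⟨
  segRow s (left s)                             ≤⟨ m≤m+n _ _ ⟩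
  segRow s (left s) + sumSegs rest (left s)     ≡⟨ seg (left s) ⟩
  T (left s)                                    ∎
  where open ≤-Reasoning

sumSegs-step : ∀ {m} (i : Fin m) (L : Segmentation (suc m)) →
  All (λ t → toℕ (right t) ≢ toℕ i) L → sumSegs L (inject₁ i) ≤ sumSegs L (fsuc i)
sumSegs-step i []      []          = z≤n
sumSegs-step i (t ∷ L) (t↛i ∷ L↛i) = +-mono-≤ segRow-step (sumSegs-step i L L↛i)
  where
  a = toℕ (left t)
  b = toℕ (right t)
  segRow-step : segRow t (inject₁ i) ≤ segRow t (fsuc i)
  segRow-step = subst (λ k → box a b (value t) k ≤ box a b (value t) (suc (toℕ i)))
                      (sym (toℕ-inject₁ i)) (box-step a b (value t) t↛i)

rise-at-left : ∀ {m} {T : Row (suc m)} (i : Fin m) (s : Segment (suc m)) (rest : Segmentation (suc m)) →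
  left s ≡ fsuc i → All (λ t → toℕ (right t) ≢ toℕ i) rest →
  IsSegmentationOf (s ∷ rest) T → T (inject₁ i) + value s ≤ T (fsuc i)
rise-at-left {T = T} i s@(segment v _ _ r l≤r) rest refl rest↛i seg = begin
  T (inject₁ i) + v                              ≡⟨ cong (_+ v) (seg (inject₁ i)) ⟨
  (segRow s (inject₁ i) + R (inject₁ i)) + v     ≡⟨ cong (λ x → (x + R (inject₁ i)) + v) s-before ⟩
  R (inject₁ i) + v                              ≤⟨ +-monoˡ-≤ v (sumSegs-step i rest rest↛i) ⟩
  R (fsuc i) + v                                 ≡⟨ +-comm (R (fsuc i)) v ⟩
  v + R (fsuc i)                                 ≡⟨ cong (_+ R (fsuc i)) (box-inside (suc (toℕ i)) (toℕ r) v ≤-refl l≤r) ⟨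
  segRow s (fsuc i) + R (fsuc i)                 ≡⟨ seg (fsuc i) ⟩
  T (fsuc i)                                     ∎
  where
  open ≤-Reasoning
  R = sumSegs rest
  s-before : segRow s (inject₁ i) ≡ 0
  s-before = box-before (suc (toℕ i)) (toℕ r) v (s≤s (≤-reflexive (toℕ-inject₁ i)))

rise⇒≤∣-∣ : ∀ x y v → x + v ≤ y → v ≤ ∣ y - x ∣
rise⇒≤∣-∣ x y v x+v≤y = begin
  v           ≡⟨ m+n∸m≡n x v ⟨
  x + v ∸ x   ≤⟨ ∸-monoˡ-≤ x x+v≤y ⟩
  y ∸ x       ≤⟨ m∸n≤∣m-n∣ y x ⟩
  ∣ y - x ∣   ∎
  where open ≤-Reasoning

maxDiff-bound : ∀ m (T : Row (suc m)) (i : Fin m) → ∣ T (fsuc i) - T (inject₁ i) ∣ ≤ maxDiff m T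
maxDiff-bound (suc m) T fzero    = m≤m⊔n _ _
maxDiff-bound (suc m) T (fsuc i) = ≤-trans (maxDiff-bound m (λ j → T (fsuc j)) i) (m≤n⊔m _ _)

rowDiff-first : ∀ {m} (T : Row (suc m)) → T fzero ≤ rowDiff T
rowDiff-first T = ≤-trans (m≤m⊔n _ _) (m≤m⊔n _ _)

rowDiff-maxDiff : ∀ {m} (T : Row (suc m)) → maxDiff m T ≤ rowDiff T
rowDiff-maxDiff T = m≤n⊔m _ _

merge-inside : ∀ {n} (s : Segment n) (rest : Segmentation n) →
  Any (λ t → suc (toℕ (right t)) ≡ toℕ (left s)) rest → Σ (Segmentation n) λ S′ → Improves S′ (s ∷ rest)
merge-inside {n} s rest ends =
  proj₁ merged ++ (rest ─ ends) ,
  improves-↭ (improves-++ʳ (rest ─ ends) (proj₂ merged)) (↭.trans (↭.swap t s ↭.refl) (↭.prep s (lookup-─ ends)))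
  where
  t : Segment n
  t = Any.lookup ends
  merged : Σ (Segmentation n) λ M → Improves M (t ∷ s ∷ [])
  merged = merge-adjacent t s (lookup-result ends)

-- One step: a segment s with value above rowDiff T cannot start at 0 and must
-- have a left neighbour ending just before it, so merging improves s ∷ rest.
improve-at : ∀ {m} {T : Row (suc m)} (s : Segment (suc m)) (rest : Segmentation (suc m)) →
  IsSegmentationOf (s ∷ rest) T → rowDiff T < value s → Σ (Segmentation (suc m)) λ S′ → Improves S′ (s ∷ rest)
improve-at {T = T} s@(segment _ _ fzero _ _) rest seg big =
  ⊥-elim (<⇒≱ big (≤-trans (value≤row-at-left s rest seg) (rowDiff-first T)))
improve-at {m} {T} s@(segment v _ (fsuc i) _ _) rest seg big with any? (λ t → toℕ (right t) ≟ toℕ i) rest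
... | yes ends = merge-inside s rest (Any.map (cong suc) ends)
... | no none  = ⊥-elim (<⇒≱ big v≤rowDiff)
  where
  open ≤-Reasoning
  v≤rowDiff : v ≤ rowDiff T
  v≤rowDiff = begin
    v                                   ≤⟨ rise⇒≤∣-∣ _ _ v (rise-at-left i s rest refl (¬Any⇒All¬ rest none) seg) ⟩
    ∣ T (fsuc i) - T (inject₁ i) ∣      ≤⟨ maxDiff-bound m T i ⟩
    maxDiff m T                         ≤⟨ rowDiff-maxDiff T ⟩
    rowDiff T                           ∎

improve : ∀ {m} {T : Row (suc m)} (S : Segmentation (suc m)) → IsSegmentationOf S T →
  Any (λ s → rowDiff T < value s) S → Σ (Segmentation (suc m)) λ S′ → Improves S′ S
improve {m} S seg big =
  proj₁ step , improves-↭ (proj₂ step) (lookup-─ big)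
  where
  step : Σ (Segmentation (suc m)) λ S′ → Improves S′ (Any.lookup big ∷ (S ─ big))
  step = improve-at (Any.lookup big) (S ─ big) (segmentation-↭ (lookup-─ big) seg) (lookup-result big)

Bounded : ∀ {m} → Row (suc m) → Segmentation (suc m) → Set
Bounded {m} T S = Σ (Segmentation (suc m)) (λ S′ →
  IsSegmentationOf S′ T × length S′ ≤ length S × All (λ s → value s ≤ rowDiff T) S′)

normalise : ∀ {m} {T : Row (suc m)} (S : Segmentation (suc m)) → IsSegmentationOf S T →
  Acc _<_ (weight S) → Bounded T S
normalise {T = T} S seg (acc lighter-accessible) with all? (λ s → value s ≤? rowDiff T) S
... | yes small = S , seg , ≤-refl , small
... | no ¬small with improve S seg (Any.map ≰⇒> (¬All⇒Any¬ (λ s → value s ≤? rowDiff T) S ¬small))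
...   | S′ , improves same shorter lighter with normalise S′ (λ j → trans (same j) (seg j)) (lighter-accessible lighter)
...     | S″ , seg″ , shorter′ , small = S″ , seg″ , ≤-trans shorter′ shorter , small

lemma6 : (m : ℕ) (T : Row (suc m)) (S : Segmentation (suc m)) →
    IsSegmentationOf S T →
    Σ (Segmentation (suc m)) (λ S′ →
      IsSegmentationOf S′ T ×
      length S′ ≤ length S ×
      All (λ s → value s ≤ rowDiff T) S′)
lemma6 m T S seg = normalise S seg (<-wellFounded (weight S))
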